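{- For every coloured ribbon graph $\mathbb{G}$, $T_{ps}(\mathbb{G}^*;w,x,y,z)=T_{ps}(\mathbb{G};y,z,w,x)$.
   Context: A ribbon graph $\mathbb{G}=(V,E)$ is a surface with boundary represented as a union of two finite sets of closed discs, vertices and edges, meeting in disjoint line segments, each on the boundary of exactly one vertex and one edge, each edge containing exactly two such segments; $F(\mathbb{G})$ is its set of boundary components. The geometric dual $\mathbb{G}^*$ is obtained by capping off each boundary component of $\mathbb{G}$ with a disc; these discs are the vertices of $\mathbb{G}^*$ and the edges are those of $\mathbb{G}$; vertices of $\mathbb{G}^*$ correspond to boundary components of $\mathbb{G}$ and boundary components of $\mathbb{G}^*$ to vertices of $\mathbb{G}$. A coloured ribbon graph is a ribbon graph with a partition $\mathcal{V}$ of $V$ into vertex colour classes and a partition $\mathcal{B}$ of $F(\mathbb{G})$ into boundary colour classes. The dual of a coloured ribbon graph is $\mathbb{G}^*$ with vertex colouring induced from the boundary colouring of $\mathbb{G}$ and boundary colouring induced from the vertex colouring of $\mathbb{G}$. Parameters: for a graph $H$, $r_H(A)$ is the rank (vertices minus components) of the spanning subgraph with edge set $A$. $b(A)$ = number of boundary components of ribbon subgraph $(V,A)$; $\rho(A)=\frac12(|A|+|V|-b(A))$. $\mathbb{G}/\mathcal{V}$: graph on the vertex colour classes with an edge for each edge of $\mathbb{G}$ joining the classes of its ends. $\mathbb{G}^*/\mathcal{B}$: graph on the boundary colour classes with an edge for each edge $e$ joining the classes of the boundary components touching $e$. $r_1(A)=r_{\mathbb{G}/\mathcal{V}}(A)$,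 $r_2(A)=\rho(A)-r_{\mathbb{G}/\mathcal{V}}(A)$, $r_3(A)=r_{\mathbb{G}^*/\mathcal{B}}(E)-r_{\mathbb{G}^*/\mathcal{B}}(E\setminus A)$, $r_4(A)=|A|+r_{\mathbb{G}^*/\mathcal{B}}(E\setminus A)-r_{\mathbb{G}^*/\mathcal{B}}(E)-\rho(A)$. The Tutte polynomial of a coloured ribbon graph is $T_{ps}(\mathbb{G};w,x,y,z)=\sum_{A\subseteq E}w^{r_1(E)-r_1(A)}x^{r_2(E)-r_2(A)}y^{r_3(A)}z^{r_4(A)}$ (all quantities computed in $\mathbb{G}$ with its colourings). -}

module Defs where

open import Data.Bool using (Bool; true; false; _∧_; _∨_; not; if_then_else_)
open import Data.Nat using (ℕ; zero; suc; _+_; _∸_; _/_)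
open import Data.Integer using (ℤ; +_; _-_; _*_)
open import Data.Fin using (Fin; zero; suc)
open import Data.Fin.Properties using () renaming (_≟_ to _≟F_)
open import Data.Vec using (Vec; []; _∷_; lookup)
open import Data.List using (List; []; _∷_; _++_; map; length; filter; allFin; cartesianProduct)
open import Data.Bool.ListAction using (any)
open import Data.Product using (Σ; _×_; _,_; ∃)
open import Data.Product.Properties using (≡-dec)
open import Data.Sum using (_⊎_)
open import Relation.Binary.PropositionalEquality using (_≡_; _≢_; refl; cong; sym; trans)
open import Relation.Binary.Definitions using (DecidableEquality)
open import Relation.Nullary.Decidable using (⌊_⌋)
open import Data.Product.Properties using (≡-dec)
import Data.Integer.Properties as ℤP
import Data.Integer

-- Generic: number of connected components of a finite graph.
-- Vertex set: the elements of a duplicate-free enumeration `xs` of X;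
-- adjacency: the symmetric closure of a Boolean relation `adj`.

iter : {A : Set} → ℕ → (A → A) → A → A
iter zero    f a = a
iter (suc n) f a = f (iter n f a)

module Components {X : Set} (_≟_ : DecidableEquality X)
                  (xs : List X) (adj : X → X → Bool) where

  step : (X → Bool) → (X → Bool)
  step S x = S x ∨ any (λ y → S y ∧ (adj y x ∨ adj x y)) xs

  -- reach x y : y is in the connected component of x
  -- (|xs| closure steps suffice)
  reach : X → X → Bool
  reach x = iter (length xs) step (λ y → ⌊ x ≟ y ⌋)

  -- count those x in xs such that no earlier element of xs lies in the
  -- component of x (i.e. x is the first representative of its component)
  countRoots : List X → List X → ℕ
  countRoots before []         = 0
  countRoots before (x ∷ rest) =
    (if any (reach x) before then 0 else 1) + countRoots (x ∷ before) rest

  ncomp : ℕ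
  ncomp = countRoots [] xs

rankGraph : (k : ℕ) → List (Fin k × Fin k) → ℕ
rankGraph k es = k ∸ Components.ncomp _≟F_ (allFin k) adj
  where
  adj : Fin k → Fin k → Bool
  adj c d = any (λ { (u , v) → ⌊ u ≟F c ⌋ ∧ ⌊ v ≟F d ⌋ }) es

-- Ribbon graphs, encoded combinatorially as graph-encoded maps (gems).
-- Each edge e has four flags (e , i , s): i ∈ Fin 2 is the end of e
-- (i.e. which of its two attaching segments), s ∈ Fin 2 is the side of e.
--   τ0 (e,i,s) = (e, 1-i, s) : run along side s of e to the other end
--   τ2 (e,i,s) = (e, i, 1-s) : cross the end i of e to the other side
--   τ1 : a fixed-point-free involution joining each flag to the
--        neighbouring flag along the boundary of the vertex disc.
-- Vertices = orbits of ⟨τ1,τ2⟩ (plus isolated vertices),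
-- boundary components = orbits of ⟨τ0,τ1⟩ (plus one per isolated vertex).

Flag : ℕ → Set
Flag m = Fin m × Fin 2 × Fin 2

flip2 : Fin 2 → Fin 2
flip2 zero       = suc zero
flip2 (suc zero) = zero

τ0 : {m : ℕ} → Flag m → Flag m
τ0 (e , i , s) = (e , flip2 i , s)

τ2 : {m : ℕ} → Flag m → Flag m
τ2 (e , i , s) = (e , i , flip2 s)

edgeOf : {m : ℕ} → Flag m → Fin m
edgeOf (e , _ , _) = e

_≟Fl_ : {m : ℕ} → DecidableEquality (Flag m)
_≟Fl_ = ≡-dec _≟F_ (≡-dec _≟F_ _≟F_)

allFlags : (m : ℕ) → List (Flag m)
allFlags m = cartesianProduct (allFin m) (cartesianProduct (allFin 2) (allFin 2))

record RibbonGraph : Set where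
  field
    nE     : ℕ
    nIso   : ℕ
    τ1     : Flag nE → Flag nE
    τ1-inv : ∀ f → τ1 (τ1 f) ≡ f
    τ1-fpf : ∀ f → τ1 f ≢ f

-- A coloured ribbon graph: vertex colour classes and boundary colour
-- classes, given by colour labels (every label used, so labels = classes).
record ColouredRibbonGraph : Set where
  field
    G : RibbonGraph
  open RibbonGraph G
  field
    kV      : ℕ
    vcol    : Flag nE → Fin kV
    vcol-τ1 : ∀ f → vcol (τ1 f) ≡ vcol f
    vcol-τ2 : ∀ f → vcol (τ2 f) ≡ vcol f
    isoV    : Fin nIso → Fin kV
    vsurj   : ∀ c → (∃ λ f → vcol f ≡ c) ⊎ (∃ λ i → isoV i ≡ c)
    kB      : ℕ
    bcol    : Flag nE → Fin kB
    bcol-τ0 : ∀ f → bcol (τ0 f) ≡ bcol f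
    bcol-τ1 : ∀ f → bcol (τ1 f) ≡ bcol f
    isoB    : Fin nIso → Fin kB
    bsurj   : ∀ c → (∃ λ f → bcol f ≡ c) ⊎ (∃ λ i → isoB i ≡ c)

-- Geometric dual.  Relabelling φ (e,i,s) = (e,s,i) conjugates τ0 and τ2,
-- so the dual is obtained by replacing τ1 with φ τ1 φ.

φ : {m : ℕ} → Flag m → Flag m
φ (e , i , s) = (e , s , i)

φφ : {m : ℕ} (f : Flag m) → φ (φ f) ≡ f
φφ (e , i , s) = refl

φτ0 : {m : ℕ} (f : Flag m) → φ (τ0 f) ≡ τ2 (φ f)
φτ0 (e , i , s) = refl

φτ2 : {m : ℕ} (f : Flag m) → φ (τ2 f) ≡ τ0 (φ f)
φτ2 (e , i , s) = refl

dualRG : RibbonGraph → RibbonGraph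
dualRG G = record
  { nE     = nE
  ; nIso   = nIso
  ; τ1     = λ f → φ (τ1 (φ f))
  ; τ1-inv = λ f → trans (cong (λ g → φ (τ1 g)) (φφ (τ1 (φ f))))
                         (trans (cong φ (τ1-inv (φ f))) (φφ f))
  ; τ1-fpf = λ f eq → τ1-fpf (φ f)
                 (trans (sym (φφ (τ1 (φ f)))) (cong φ eq))
  }
  where open RibbonGraph G

dual : ColouredRibbonGraph → ColouredRibbonGraph
dual C = record
  { G       = dualRG G
  ; kV      = kB
  ; vcol    = λ f → bcol (φ f)
  ; vcol-τ1 = λ f → trans (cong bcol (φφ (τ1 (φ f)))) (bcol-τ1 (φ f))
  ; vcol-τ2 = λ f → trans (cong bcol (φτ2 f)) (bcol-τ0 (φ f))
  ; isoV    = isoB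
  ; vsurj   = λ c → Data.Sum.map (λ { (f , eq) → φ f , trans (cong bcol (φφ f)) eq })
                                 (λ p → p) (bsurj c)
  ; kB      = kV
  ; bcol    = λ f → vcol (φ f)
  ; bcol-τ0 = λ f → trans (cong vcol (φτ0 f)) (vcol-τ2 (φ f))
  ; bcol-τ1 = λ f → trans (cong vcol (φφ (τ1 (φ f)))) (vcol-τ1 (φ f))
  ; isoB    = isoV
  ; bsurj   = λ c → Data.Sum.map (λ { (f , eq) → φ f , trans (cong vcol (φφ f)) eq })
                                 (λ p → p) (vsurj c)
  }
  where open ColouredRibbonGraph C
        open RibbonGraph G
        import Data.Sum

EdgeSet : ℕ → Set
EdgeSet m = Vec Bool m

allSubsets : (m : ℕ) → List (EdgeSet m)
allSubsets zero    = [] ∷ []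
allSubsets (suc m) = map (true ∷_) (allSubsets m) ++ map (false ∷_) (allSubsets m)

_∈ₑ_ : {m : ℕ} → Fin m → EdgeSet m → Bool
e ∈ₑ A = lookup A e

card : {m : ℕ} → EdgeSet m → ℕ
card []          = 0
card (true ∷ A)  = suc (card A)
card (false ∷ A) = card A

fullSet : (m : ℕ) → EdgeSet m
fullSet zero    = []
fullSet (suc m) = true ∷ fullSet m

complement : {m : ℕ} → EdgeSet m → EdgeSet m
complement []      = []
complement (b ∷ A) = not b ∷ complement A

elems : {m : ℕ} → EdgeSet m → List (Fin m)
elems {m} A = filter (λ e → Data.Bool._≟_ (e ∈ₑ A) true) (allFin m)
  where import Data.Bool

module Params (C : ColouredRibbonGraph) where
  open ColouredRibbonGraph C
  open RibbonGraph G

  nV : ℕ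
  nV = Components.ncomp _≟Fl_ (allFlags nE)
         (λ f g → ⌊ g ≟Fl τ1 f ⌋ ∨ ⌊ g ≟Fl τ2 f ⌋) + nIso

  -- b(A): boundary components of the ribbon subgraph (V,A).  Walking along
  -- the boundary of (V,A): along vertex arcs (τ1), along the sides of
  -- edges of A (τ0), and across the attaching segments of edges not in A
  -- (τ2).  Each isolated vertex contributes one boundary component.
  b : EdgeSet nE → ℕ
  b A = Components.ncomp _≟Fl_ (allFlags nE)
          (λ f g → ⌊ g ≟Fl τ1 f ⌋
                 ∨ ((edgeOf f ∈ₑ A) ∧ ⌊ g ≟Fl τ0 f ⌋)
                 ∨ (not (edgeOf f ∈ₑ A) ∧ ⌊ g ≟Fl τ2 f ⌋)) + nIso

  -- ρ(A) = ½(|A| + |V| - b(A)).  This is a half-integer in general (it is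
  -- an integer plus half the Euler genus), so we work with 2ρ(A) and with
  -- doubled exponents throughout: twice each exponent is an integer.
  twoρ : EdgeSet nE → ℤ
  twoρ A = ((+ card A) Data.Integer.+ (+ nV)) - (+ b A)

  -- rank in G/𝒱 : edge e joins the colour classes of the vertices at its ends
  rV : EdgeSet nE → ℕ
  rV A = rankGraph kV (map (λ e → vcol (e , zero , zero) , vcol (e , suc zero , zero)) (elems A))

  -- rank in G*/ℬ : edge e joins the classes of the boundary components
  -- on its two sides
  rB : EdgeSet nE → ℕ
  rB A = rankGraph kB (map (λ e → bcol (e , zero , zero) , bcol (e , zero , suc zero)) (elems A))

  E : EdgeSet nE
  E = fullSet nE

  two : ℤ
  two = + 2

  2r₁ 2r₂ 2r₃ 2r₄ : EdgeSet nE → ℤ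
  2r₁ A = two * (+ rV A)
  2r₂ A = twoρ A - two * (+ rV A)
  2r₃ A = two * ((+ rB E) - (+ rB (complement A)))
  2r₄ A = (two * (((+ card A) Data.Integer.+ (+ rB (complement A))) - (+ rB E))) - twoρ A

  -- twice the exponents of w, x, y, z in the term of A
  exps : EdgeSet nE → ℤ × ℤ × ℤ × ℤ
  exps A = (2r₁ E - 2r₁ A , 2r₂ E - 2r₂ A , 2r₃ A , 2r₄ A)

-- Polynomials in w,x,y,z with natural coefficients and (possibly)
-- half-integer exponents, represented by their coefficient function:
-- (2·exp of w, 2·exp of x, 2·exp of y, 2·exp of z) ↦ coefficient.

Poly4 : Set
Poly4 = ℤ × ℤ × ℤ × ℤ → ℕ

_≟ℤ⁴_ : DecidableEquality (ℤ × ℤ × ℤ × ℤ)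
_≟ℤ⁴_ = ≡-dec ℤP._≟_ (≡-dec ℤP._≟_ (≡-dec ℤP._≟_ ℤP._≟_))

Tps : ColouredRibbonGraph → Poly4
Tps C k = length (filter (λ A → exps A ≟ℤ⁴ k) (allSubsets nE))
  where open ColouredRibbonGraph C
        open RibbonGraph G
        open Params C

-- P(y,z,w,x) as a polynomial in (w,x,y,z): the coefficient of
-- w^a x^b y^c z^d in P(y,z,w,x) is the coefficient of w^c x^d y^a z^b in P
-- (here a,b,c,d are doubled exponents).
substYZWX : Poly4 → Poly4
substYZWX P (a , b , c , d) = P (c , d , a , b)

-- The dual is the same flag system with τ1 conjugated by φ (e,i,s) = (e,s,i),
-- which exchanges τ0 and τ2.  Relabelling the flags by φ therefore identifies
-- the vertices of G* with the boundary components of G, and the boundary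
-- components of (V*, A) with those of (V, E∖A); in particular |V*| = b(E),
-- and b(∅) = |V|.  The two colour graphs swap roles, so substituting into the
-- four exponents shows that A contributes to T(G*) the monomial that E∖A
-- contributes to T(G) with (w,x) and (y,z) exchanged, and A ↦ E∖A is a
-- bijection of edge sets.  Component counts are invariant under relabelling
-- and reordering because reachability is an equivalence relation: closing a
-- set under adjacency stabilises after as many steps as there are flags.

module Submission where

open import Defs

open import Data.Bool using (Bool; true; false; T; _∧_; _∨_; not; if_then_else_)
open import Data.Bool.ListAction using (any; or)
open import Data.Bool.Properties using (T?; T-∨; T-∧; ∨-comm; ∨-identityʳ; if-not)
open import Data.Empty using (⊥-elim)
open import Data.Fin using (Fin; zero; suc)
import Data.Integer as ℤ
open import Data.Integer using (ℤ)
open import Data.List using (List; []; _∷_; _++_; map; length; filter; allFin; cartesianProduct)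
open import Data.List.Properties using (map-cong; map-∘; length-map; map-++; filter-≐)
open import Data.List.Membership.Propositional using (_∈_; find; lose)
open import Data.List.Membership.Propositional.Properties using (∈-cartesianProduct⁺; ∈-allFin)
open import Data.List.Relation.Unary.Any using (here; there; any?)
open import Data.List.Relation.Unary.Any.Properties using (any⁺; any⁻)
import Data.List.Relation.Binary.Permutation.Propositional as ↭
open import Data.List.Relation.Binary.Permutation.Propositional
  using (_↭_; ↭-refl; ↭-sym; prep; swap; module PermutationReasoning)
open import Data.List.Relation.Binary.Permutation.Propositional.Properties
  using (Any-resp-↭; ↭-length; ++⁺; ++-comm; map⁺; filter-↭)
open import Data.Nat using (ℕ; zero; suc; _+_; _≤_; _<_; z≤n; s≤s)
open import Data.Nat.Properties
  using (≤-trans; m≤n⇒m≤1+n; m≤n+m; +-suc; +-identityʳ; +-monoˡ-≤; <-irrefl; +-commutativeSemigroup)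
open import Algebra.Properties.CommutativeSemigroup +-commutativeSemigroup using (x∙yz≈y∙xz)
open import Data.Product using (∃; _×_; _,_)
open import Data.Sum using (_⊎_; inj₁; inj₂)
open import Data.Vec using ([]; _∷_)
open import Function using (_∘_; _⇔_; mk⇔; Injective)
open import Function.Bundles using (module Equivalence)
open import Relation.Binary.Definitions using (DecidableEquality)
open import Relation.Binary.PropositionalEquality
  using (_≡_; refl; sym; trans; cong; cong₂; subst; _≗_; module ≡-Reasoning)
open import Relation.Nullary using (yes; no; ¬_)
open import Relation.Nullary.Decidable
  using (⌊_⌋; ¬?; _×-dec_; toWitness; fromWitness; isYes≗does; dec-true; dec-false)
open import Relation.Unary using (Pred; Decidable; _≐_)

open Equivalence using (to; from)

T-injective : ∀ {a b} → T a ⇔ T b → a ≡ b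
T-injective {false} {false} _   = refl
T-injective {false} {true}  a⇔b = ⊥-elim (from a⇔b _)
T-injective {true}  {false} a⇔b = ⊥-elim (to a⇔b _)
T-injective {true}  {true}  _   = refl

any-cong : ∀ {A : Set} {p q : A → Bool} → p ≗ q → any p ≗ any q
any-cong p≗q xs = cong or (map-cong p≗q xs)

any-map : ∀ {A B : Set} (p : B → Bool) (f : A → B) → any p ∘ map f ≗ any (p ∘ f)
any-map p f xs = cong or (sym (map-∘ xs))

any-resp-↭ : ∀ {A : Set} (p : A → Bool) {xs ys} → xs ↭ ys → any p xs ≡ any p ys
any-resp-↭ p xs↭ys = T-injective (mk⇔ (any⁺ p ∘ Any-resp-↭ xs↭ys ∘ any⁻ p _)
                                      (any⁺ p ∘ Any-resp-↭ (↭-sym xs↭ys) ∘ any⁻ p _))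

∧∨not∧≡if : ∀ u x y → (u ∧ x) ∨ (not u ∧ y) ≡ (if u then x else y)
∧∨not∧≡if true  x y = ∨-identityʳ x
∧∨not∧≡if false x y = refl

filter-map : ∀ {A B : Set} {ℓ} {P : Pred B ℓ} (P? : Decidable P) (f : A → B) xs →
             filter P? (map f xs) ≡ map f (filter (P? ∘ f) xs)
filter-map P? f []       = refl
filter-map P? f (x ∷ xs) with P? (f x)
... | yes _ = cong (f x ∷_) (filter-map P? f xs)
... | no _  = filter-map P? f xs

module _ {X : Set} (_≟_ : DecidableEquality X) where

  ⌊≟⌋-injective : {φ : X → X} → Injective _≡_ _≡_ φ → ∀ x y → ⌊ φ x ≟ φ y ⌋ ≡ ⌊ x ≟ y ⌋
  ⌊≟⌋-injective {φ} inj x y with x ≟ y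
  ... | yes refl = trans (isYes≗does _) (dec-true (φ x ≟ φ x) refl)
  ... | no x≢y   = trans (isYes≗does _) (dec-false (φ x ≟ φ y) (x≢y ∘ inj))

  involutive⇒injective : {φ : X → X} → (∀ x → φ (φ x) ≡ x) → Injective _≡_ _≡_ φ
  involutive⇒injective {φ} φφ {x} {y} φx≡φy = trans (sym (φφ x)) (trans (cong φ φx≡φy) (φφ y))

  ⌊≟⌋-involutive : {φ : X → X} → (∀ x → φ (φ x) ≡ x) → ∀ x y → ⌊ x ≟ φ y ⌋ ≡ ⌊ φ x ≟ y ⌋
  ⌊≟⌋-involutive {φ} φφ x y = trans (sym (⌊≟⌋-injective (involutive⇒injective φφ) x (φ y)))
                                    (cong (λ z → ⌊ φ x ≟ z ⌋) (φφ y))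

_⊆ᵇ_ : {X : Set} → (X → Bool) → (X → Bool) → Set
S ⊆ᵇ S′ = ∀ {x} → T (S x) → T (S′ x)

count : {X : Set} → (X → Bool) → List X → ℕ
count S []       = 0
count S (x ∷ xs) = if S x then suc (count S xs) else count S xs

module _ {X : Set} {S : X → Bool} where

  count≤length : ∀ xs → count S xs ≤ length xs
  count≤length []       = z≤n
  count≤length (x ∷ xs) with S x
  ... | true  = s≤s (count≤length xs)
  ... | false = m≤n⇒m≤1+n (count≤length xs)

  length≤count⇒all : ∀ {xs y} → length xs ≤ count S xs → y ∈ xs → T (S y)
  length≤count⇒all {x ∷ xs} full y∈ with S x in Sx
  ... | false = ⊥-elim (<-irrefl refl (≤-trans full (count≤length xs)))
  length≤count⇒all {x ∷ xs} _          (here refl) | true = subst T (sym Sx) _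
  length≤count⇒all {x ∷ xs} (s≤s full) (there y∈)  | true = length≤count⇒all full y∈

module _ {X : Set} {S S′ : X → Bool} (S⊆S′ : S ⊆ᵇ S′) where

  count-mono : ∀ xs → count S xs ≤ count S′ xs
  count-mono []       = z≤n
  count-mono (x ∷ xs) with S x | S′ x | S⊆S′ {x}
  ... | true  | true  | _    = s≤s (count-mono xs)
  ... | true  | false | incl = ⊥-elim (incl _)
  ... | false | true  | _    = m≤n⇒m≤1+n (count-mono xs)
  ... | false | false | _    = count-mono xs

  count-mono-< : ∀ {xs y} → y ∈ xs → ¬ T (S y) → T (S′ y) → count S xs < count S′ xs
  count-mono-< {x ∷ xs} (here refl) ¬Sx S′x with S x | S′ x
  ... | true  | _     = ⊥-elim (¬Sx _)
  ... | false | false = ⊥-elim S′x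
  ... | false | true  = s≤s (count-mono xs)
  count-mono-< {x ∷ xs} (there y∈) ¬Sy S′y with S x | S′ x | S⊆S′ {x}
  ... | true  | true  | _    = s≤s (count-mono-< y∈ ¬Sy S′y)
  ... | true  | false | incl = ⊥-elim (incl _)
  ... | false | true  | _    = m≤n⇒m≤1+n (count-mono-< y∈ ¬Sy S′y)
  ... | false | false | _    = count-mono-< y∈ ¬Sy S′y

iter-shift : ∀ {A : Set} (f : A → A) k a → iter k f (f a) ≡ iter (suc k) f a
iter-shift f zero    a = refl
iter-shift f (suc k) a = cong f (iter-shift f k a)

iter-cong : ∀ {X : Set} {f g : (X → Bool) → (X → Bool)} →
            (∀ {S S′} → S ≗ S′ → f S ≗ g S′) → ∀ k {S S′} → S ≗ S′ → iter k f S ≗ iter k g S′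
iter-cong f≈g zero    S≗S′ = S≗S′
iter-cong f≈g (suc k) S≗S′ = f≈g (iter-cong f≈g k S≗S′)

newRoot : Bool → ℕ
newRoot u = if u then 0 else 1

newRoot-swap : ∀ u p q c → (T u → p ≡ q) →
               newRoot p + (newRoot (u ∨ q) + c) ≡ newRoot q + (newRoot (u ∨ p) + c)
newRoot-swap true  p q c p≡q = cong (λ w → newRoot w + c) (p≡q _)
newRoot-swap false p q c _   = x∙yz≈y∙xz (newRoot p) (newRoot q) c

module ComponentsProperties {X : Set} (_≟_ : DecidableEquality X) (xs : List X) (adj : X → X → Bool) where
  open Components _≟_ xs adj

  Closed : (X → Bool) → Set
  Closed S = step S ⊆ᵇ S

  linked : X → X → Bool
  linked y x = adj y x ∨ adj x y

  linked-sym : ∀ x y → linked x y ≡ linked y x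
  linked-sym x y = ∨-comm (adj x y) (adj y x)

  step-inflationary : ∀ {S} → S ⊆ᵇ step S
  step-inflationary Sx = from T-∨ (inj₁ Sx)

  step-intro : ∀ {S x y} → y ∈ xs → T (S y) → T (linked y x) → T (step S x)
  step-intro y∈ Sy yx = from T-∨ (inj₂ (any⁺ _ (lose y∈ (from T-∧ (Sy , yx)))))

  step-elim : ∀ {S x} → T (step S x) → T (S x) ⊎ ∃ λ y → y ∈ xs × T (S y) × T (linked y x)
  step-elim stepSx with to T-∨ stepSx
  ... | inj₁ Sx = inj₁ Sx
  ... | inj₂ a with find (any⁻ _ xs a)
  ... | y , y∈ , Sy∧yx = inj₂ (y , y∈ , to T-∧ Sy∧yx)

  step-mono : ∀ {S S′} → S ⊆ᵇ S′ → step S ⊆ᵇ step S′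
  step-mono S⊆S′ stepSx with step-elim stepSx
  ... | inj₁ Sx                 = step-inflationary (S⊆S′ Sx)
  ... | inj₂ (y , y∈ , Sy , yx) = step-intro y∈ (S⊆S′ Sy) yx

  iter-inflationary : ∀ k {S} → S ⊆ᵇ iter k step S
  iter-inflationary zero    Sx = Sx
  iter-inflationary (suc k) Sx = step-inflationary (iter-inflationary k Sx)

  iter-least : ∀ {S U} → Closed U → S ⊆ᵇ U → ∀ k → iter k step S ⊆ᵇ U
  iter-least closed S⊆U zero    = S⊆U
  iter-least closed S⊆U (suc k) = closed ∘ step-mono (iter-least closed S⊆U k)

  iter-preserves-Closed : ∀ {S} → Closed S → ∀ k → Closed (iter k step S)
  iter-preserves-Closed closed k =
    iter-inflationary k ∘ closed ∘ step-mono (iter-least closed (λ Sx → Sx) k)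

  countRoots-↭-before : ∀ {b b′} → b ↭ b′ → ∀ r → countRoots b r ≡ countRoots b′ r
  countRoots-↭-before b↭b′ []      = refl
  countRoots-↭-before b↭b′ (x ∷ r) = cong₂ (λ u c → newRoot u + c)
    (any-resp-↭ (reach x) b↭b′) (countRoots-↭-before (prep x b↭b′) r)

  module _ (complete : ∀ x → x ∈ xs) where

    -- A step either closes S or adds an element of xs, so after
    -- length xs ∸ count S xs steps the set is closed.
    iter-closed : ∀ k S → length xs ≤ count S xs + k → Closed (iter k step S)
    iter-closed zero S full {x} _ =
      length≤count⇒all (subst (length xs ≤_) (+-identityʳ _) full) (complete x)
    iter-closed (suc k) S bound
      with any? (λ y → ¬? (T? (S y)) ×-dec T? (step S y)) xs
    ... | yes grows =
      subst Closed (iter-shift step k S) (iter-closed k (step S) (≤-trans bound grown))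
      where
      grown : count S xs + suc k ≤ count (step S) xs + k
      grown = let y , y∈ , ¬Sy , stepSy = find grows in
              subst (_≤ count (step S) xs + k) (sym (+-suc (count S xs) k))
                    (+-monoˡ-≤ k (count-mono-< step-inflationary y∈ ¬Sy stepSy))
    ... | no stable = iter-preserves-Closed closed (suc k)
      where
      closed : Closed S
      closed {y} stepSy with T? (S y)
      ... | yes Sy  = Sy
      ... | no ¬Sy  = ⊥-elim (stable (lose (complete y) (¬Sy , stepSy)))

    reach-closed : ∀ x → Closed (reach x)
    reach-closed x = iter-closed (length xs) _ (m≤n+m (length xs) _)

    reach-refl : ∀ x → T (reach x x)
    reach-refl x = iter-inflationary (length xs) (fromWitness refl)

    reach-trans : ∀ {x y z} → T (reach x y) → T (reach y z) → T (reach x z)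
    reach-trans {x} xy = iter-least (reach-closed x) (λ y≡w → subst (T ∘ reach x) (toWitness y≡w) xy) (length xs)

    reach-linked : ∀ {x y} → T (linked x y) → T (reach x y)
    reach-linked {x} xy = reach-closed x (step-intro (complete x) (reach-refl x) xy)

    reach-sym : ∀ {x y} → T (reach x y) → T (reach y x)
    reach-sym {x} = iter-least closed (λ x≡w → subst (λ w → T (reach w x)) (toWitness x≡w) (reach-refl x)) (length xs)
      where
      closed : Closed (λ w → reach w x)
      closed stepw with step-elim stepw
      ... | inj₁ wx = wx
      ... | inj₂ (v , _ , vx , vw) = reach-trans (reach-linked (subst T (linked-sym v _) vw)) vx

    reach-sym≡ : ∀ x y → reach x y ≡ reach y x
    reach-sym≡ x y = T-injective (mk⇔ reach-sym reach-sym)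

    same-reach : ∀ {x y} → T (reach x y) → reach x ≗ reach y
    same-reach xy z = T-injective (mk⇔ (reach-trans (reach-sym xy)) (reach-trans xy))

    countRoots-swap : ∀ b x y r → countRoots b (x ∷ y ∷ r) ≡ countRoots b (y ∷ x ∷ r)
    countRoots-swap b x y r = begin
      newRoot (any (reach x) b) + (newRoot (reach y x ∨ any (reach y) b) + countRoots (y ∷ x ∷ b) r)
        ≡⟨ cong (λ u → newRoot (any (reach x) b) + (newRoot (u ∨ any (reach y) b) + countRoots (y ∷ x ∷ b) r))
                (reach-sym≡ y x) ⟩
      newRoot (any (reach x) b) + (newRoot (reach x y ∨ any (reach y) b) + countRoots (y ∷ x ∷ b) r)
        ≡⟨ newRoot-swap (reach x y) _ _ _ (λ xy → any-cong (same-reach xy) b) ⟩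
      newRoot (any (reach y) b) + (newRoot (reach x y ∨ any (reach x) b) + countRoots (y ∷ x ∷ b) r)
        ≡⟨ cong (λ c → newRoot (any (reach y) b) + (newRoot (reach x y ∨ any (reach x) b) + c))
                (countRoots-↭-before (swap y x ↭-refl) r) ⟩
      newRoot (any (reach y) b) + (newRoot (reach x y ∨ any (reach x) b) + countRoots (x ∷ y ∷ b) r) ∎
      where open ≡-Reasoning

    countRoots-↭ : ∀ {r r′} → r ↭ r′ → ∀ b → countRoots b r ≡ countRoots b r′
    countRoots-↭ ↭.refl                  b = refl
    countRoots-↭ (prep x r↭r′)           b = cong (newRoot (any (reach x) b) +_) (countRoots-↭ r↭r′ (x ∷ b))
    countRoots-↭ (swap {xs = r} x y r↭r′) b = trans (countRoots-swap b x y r)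
      (cong (λ c → newRoot (any (reach y) b) + (newRoot (reach x y ∨ any (reach x) b) + c))
            (countRoots-↭ r↭r′ (x ∷ y ∷ b)))
    countRoots-↭ (↭.trans r↭s s↭r′)      b = trans (countRoots-↭ r↭s b) (countRoots-↭ s↭r′ b)

module _ {X : Set} (_≟_ : DecidableEquality X) where

  module _ {xs ys : List X} {adj adj′ : X → X → Bool} where
    private
      module C  = Components _≟_ xs adj
      module C′ = Components _≟_ ys adj′

    countRoots-cong : length xs ≡ length ys → (∀ {S S′} → S ≗ S′ → C.step S ≗ C′.step S′) →
                      ∀ b r → C.countRoots b r ≡ C′.countRoots b r
    countRoots-cong length≡ step≈ b []      = refl
    countRoots-cong length≡ step≈ b (x ∷ r) =
      cong₂ (λ u c → newRoot u + c) (any-cong reach≡ b) (countRoots-cong length≡ step≈ (x ∷ b) r)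
      where
      reach≡ : C.reach x ≗ C′.reach x
      reach≡ y = trans (iter-cong step≈ (length xs) (λ _ → refl) y)
                       (cong (λ n → iter n C′.step (λ z → ⌊ x ≟ z ⌋) y) length≡)

  ncomp-cong : ∀ xs {adj adj′ : X → X → Bool} → (∀ x y → adj x y ≡ adj′ x y) →
               Components.ncomp _≟_ xs adj ≡ Components.ncomp _≟_ xs adj′
  ncomp-cong xs {adj} {adj′} adj≡ = countRoots-cong {xs} {xs} {adj} {adj′} refl step≈ [] xs
    where
    step≈ : ∀ {S S′} → S ≗ S′ → Components.step _≟_ xs adj S ≗ Components.step _≟_ xs adj′ S′
    step≈ S≗S′ z = cong₂ _∨_ (S≗S′ z)
      (any-cong (λ y → cong₂ _∧_ (S≗S′ y) (cong₂ _∨_ (adj≡ y z) (adj≡ z y))) xs)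

  ncomp-↭ : ∀ {xs ys} (adj : X → X → Bool) → xs ↭ ys → (∀ x → x ∈ ys) →
            Components.ncomp _≟_ xs adj ≡ Components.ncomp _≟_ ys adj
  ncomp-↭ {xs} {ys} adj xs↭ys complete =
    trans (countRoots-cong {xs} {ys} {adj} {adj} (↭-length xs↭ys) step≈ [] xs)
          (ComponentsProperties.countRoots-↭ _≟_ ys adj complete xs↭ys [])
    where
    step≈ : ∀ {S S′} → S ≗ S′ → Components.step _≟_ xs adj S ≗ Components.step _≟_ ys adj S′
    step≈ S≗S′ z = cong₂ _∨_ (S≗S′ z)
      (trans (any-cong (λ y → cong (_∧ _) (S≗S′ y)) xs) (any-resp-↭ _ xs↭ys))

  module _ {φ : X → X} (φ-injective : Injective _≡_ _≡_ φ) (xs : List X) (adj : X → X → Bool) where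
    private
      module D = Components _≟_ xs (λ f g → adj (φ f) (φ g))
      module G = Components _≟_ (map φ xs) adj

    iter-step-map : ∀ k {S S′} → S′ ≗ S ∘ φ → iter k D.step S′ ≗ iter k G.step S ∘ φ
    iter-step-map zero    S′≗Sφ = S′≗Sφ
    iter-step-map (suc k) S′≗Sφ x = cong₂ _∨_ (iter-step-map k S′≗Sφ x)
      (trans (any-cong (λ y → cong (_∧ _) (iter-step-map k S′≗Sφ y)) xs) (sym (any-map _ φ xs)))

    reach-map : ∀ x y → D.reach x y ≡ G.reach (φ x) (φ y)
    reach-map x y =
      trans (iter-step-map (length xs) (λ z → sym (⌊≟⌋-injective _≟_ φ-injective x z)) y)
            (cong (λ n → iter n G.step (λ z → ⌊ φ x ≟ z ⌋) (φ y)) (sym (length-map φ xs)))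

    countRoots-map : ∀ b r → D.countRoots b r ≡ G.countRoots (map φ b) (map φ r)
    countRoots-map b []      = refl
    countRoots-map b (x ∷ r) = cong₂ (λ u c → newRoot u + c)
      (trans (any-cong (reach-map x) b) (sym (any-map _ φ b))) (countRoots-map (x ∷ b) r)

  ncomp-conj : ∀ {φ : X → X} → (∀ x → φ (φ x) ≡ x) → ∀ {xs} → map φ xs ↭ xs → (∀ x → x ∈ xs) →
               ∀ {adj adj′} → (∀ f g → adj f g ≡ adj′ (φ f) (φ g)) →
               Components.ncomp _≟_ xs adj ≡ Components.ncomp _≟_ xs adj′
  ncomp-conj {φ} φφ {xs} φxs↭xs complete {adj} {adj′} adj≡ = begin
    Components.ncomp _≟_ xs adj
      ≡⟨ ncomp-cong xs adj≡ ⟩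
    Components.ncomp _≟_ xs (λ f g → adj′ (φ f) (φ g))
      ≡⟨ countRoots-map (involutive⇒injective _≟_ φφ) xs adj′ [] xs ⟩
    Components.ncomp _≟_ (map φ xs) adj′
      ≡⟨ ncomp-↭ adj′ φxs↭xs complete ⟩
    Components.ncomp _≟_ xs adj′ ∎
    where open ≡-Reasoning

lookup-fullSet : ∀ {m} (e : Fin m) → e ∈ₑ fullSet m ≡ true
lookup-fullSet zero    = refl
lookup-fullSet (suc e) = lookup-fullSet e

lookup-complement : ∀ {m} (A : EdgeSet m) e → e ∈ₑ complement A ≡ not (e ∈ₑ A)
lookup-complement (a ∷ A) zero    = refl
lookup-complement (a ∷ A) (suc e) = lookup-complement A e

complement-involutive : ∀ {m} (A : EdgeSet m) → complement (complement A) ≡ A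
complement-involutive []          = refl
complement-involutive (true ∷ A)  = cong (true ∷_) (complement-involutive A)
complement-involutive (false ∷ A) = cong (false ∷_) (complement-involutive A)

card-fullSet : ∀ m → card (fullSet m) ≡ m
card-fullSet zero    = refl
card-fullSet (suc m) = cong suc (card-fullSet m)

card-complement : ∀ {m} (A : EdgeSet m) → card A + card (complement A) ≡ m
card-complement []          = refl
card-complement (true ∷ A)  = cong suc (card-complement A)
card-complement (false ∷ A) = trans (+-suc (card A) _) (cong suc (card-complement A))

card-fullSet-split : ∀ {m} (A : EdgeSet m) → card (fullSet m) ≡ card A + card (complement A)
card-fullSet-split {m} A = trans (card-fullSet m) (sym (card-complement A))

map-complement-allSubsets : ∀ m → map complement (allSubsets m) ↭ allSubsets m
map-complement-allSubsets zero    = ↭-refl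
map-complement-allSubsets (suc m) = begin
  map complement (map (true ∷_) S ++ map (false ∷_) S)
    ≡⟨ map-++ complement (map (true ∷_) S) _ ⟩
  map complement (map (true ∷_) S) ++ map complement (map (false ∷_) S)
    ≡⟨ cong₂ _++_ (trans (sym (map-∘ S)) (map-∘ S)) (trans (sym (map-∘ S)) (map-∘ S)) ⟩
  map (false ∷_) (map complement S) ++ map (true ∷_) (map complement S)
    ↭⟨ ++⁺ (map⁺ _ (map-complement-allSubsets m)) (map⁺ _ (map-complement-allSubsets m)) ⟩
  map (false ∷_) S ++ map (true ∷_) S
    ↭⟨ ++-comm (map (false ∷_) S) _ ⟩
  map (true ∷_) S ++ map (false ∷_) S ∎
  where
  open PermutationReasoning
  S = allSubsets m

count-complement : ∀ m {ℓ} {P : Pred (EdgeSet m) ℓ} (P? : Decidable P) →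
                   length (filter P? (allSubsets m)) ≡ length (filter (P? ∘ complement) (allSubsets m))
count-complement m P? = begin
  length (filter P? (allSubsets m))
    ≡⟨ ↭-length (filter-↭ P? (map-complement-allSubsets m)) ⟨
  length (filter P? (map complement (allSubsets m)))
    ≡⟨ cong length (filter-map P? complement (allSubsets m)) ⟩
  length (map complement (filter (P? ∘ complement) (allSubsets m)))
    ≡⟨ length-map complement (filter (P? ∘ complement) (allSubsets m)) ⟩
  length (filter (P? ∘ complement) (allSubsets m)) ∎
  where open ≡-Reasoning

allFlags-complete : ∀ {m} (f : Flag m) → f ∈ allFlags m
allFlags-complete (e , i , s) = ∈-cartesianProduct⁺ (∈-allFin e) (∈-cartesianProduct⁺ (∈-allFin i) (∈-allFin s))

map-φ-allFlags : ∀ m → map φ (allFlags m) ↭ allFlags m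
map-φ-allFlags m = go (allFin m)
  where
  ends×sides : List (Fin 2 × Fin 2)
  ends×sides = cartesianProduct (allFin 2) (allFin 2)

  go : (es : List (Fin m)) → map φ (cartesianProduct es ends×sides) ↭ cartesianProduct es ends×sides
  go []       = ↭-refl
  go (e ∷ es) = subst (_↭ cartesianProduct (e ∷ es) ends×sides)
                      (sym (map-++ φ (map (e ,_) ends×sides) (cartesianProduct es ends×sides)))
                      (++⁺ (prep _ (swap _ _ ↭-refl)) (go es))

⌊≟Fl-φ⌋ : ∀ {m} (f g : Flag m) → ⌊ f ≟Fl φ g ⌋ ≡ ⌊ φ f ≟Fl g ⌋
⌊≟Fl-φ⌋ = ⌊≟⌋-involutive _≟Fl_ φφ

-- The adjacencies of Params.nV and Params.b, abstracted over τ1 so that they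
-- also describe the dual.
vertexAdj : ∀ {m} → (Flag m → Flag m) → Flag m → Flag m → Bool
vertexAdj τ1 f g = ⌊ g ≟Fl τ1 f ⌋ ∨ ⌊ g ≟Fl τ2 f ⌋

boundaryAdj : ∀ {m} → (Flag m → Flag m) → EdgeSet m → Flag m → Flag m → Bool
boundaryAdj τ1 A f g = ⌊ g ≟Fl τ1 f ⌋
                     ∨ ((edgeOf f ∈ₑ A) ∧ ⌊ g ≟Fl τ0 f ⌋)
                     ∨ (not (edgeOf f ∈ₑ A) ∧ ⌊ g ≟Fl τ2 f ⌋)

vertexAdj-dual : ∀ {m} (τ1 : Flag m → Flag m) f g →
                 vertexAdj (φ ∘ τ1 ∘ φ) f g ≡ boundaryAdj τ1 (fullSet m) (φ f) (φ g)
vertexAdj-dual τ1 f@(e , _ , _) g = cong₂ _∨_ (⌊≟Fl-φ⌋ g (τ1 (φ f))) (begin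
  ⌊ g ≟Fl φ (τ0 (φ f)) ⌋
    ≡⟨ ⌊≟Fl-φ⌋ g (τ0 (φ f)) ⟩
  ⌊ φ g ≟Fl τ0 (φ f) ⌋
    ≡⟨ cong (λ u → if u then ⌊ φ g ≟Fl τ0 (φ f) ⌋ else ⌊ φ g ≟Fl τ2 (φ f) ⌋) (lookup-fullSet e) ⟨
  (if e ∈ₑ fullSet _ then ⌊ φ g ≟Fl τ0 (φ f) ⌋ else ⌊ φ g ≟Fl τ2 (φ f) ⌋)
    ≡⟨ ∧∨not∧≡if (e ∈ₑ fullSet _) _ _ ⟨
  (e ∈ₑ fullSet _ ∧ ⌊ φ g ≟Fl τ0 (φ f) ⌋) ∨ (not (e ∈ₑ fullSet _) ∧ ⌊ φ g ≟Fl τ2 (φ f) ⌋) ∎)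
  where open ≡-Reasoning

boundaryAdj-dual : ∀ {m} (τ1 : Flag m → Flag m) A f g →
                   boundaryAdj (φ ∘ τ1 ∘ φ) A f g ≡ boundaryAdj τ1 (complement A) (φ f) (φ g)
boundaryAdj-dual τ1 A f@(e , _ , _) g = cong₂ _∨_ (⌊≟Fl-φ⌋ g (τ1 (φ f))) (begin
  (e ∈ₑ A ∧ ⌊ g ≟Fl φ (τ2 (φ f)) ⌋) ∨ (not (e ∈ₑ A) ∧ ⌊ g ≟Fl φ (τ0 (φ f)) ⌋)
    ≡⟨ ∧∨not∧≡if (e ∈ₑ A) _ _ ⟩
  (if e ∈ₑ A then ⌊ g ≟Fl φ (τ2 (φ f)) ⌋ else ⌊ g ≟Fl φ (τ0 (φ f)) ⌋)
    ≡⟨ cong₂ (λ x y → if e ∈ₑ A then x else y) (⌊≟Fl-φ⌋ g _) (⌊≟Fl-φ⌋ g _) ⟩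
  (if e ∈ₑ A then ⌊ φ g ≟Fl τ2 (φ f) ⌋ else ⌊ φ g ≟Fl τ0 (φ f) ⌋)
    ≡⟨ if-not (e ∈ₑ A) ⟨
  (if not (e ∈ₑ A) then ⌊ φ g ≟Fl τ0 (φ f) ⌋ else ⌊ φ g ≟Fl τ2 (φ f) ⌋)
    ≡⟨ cong (λ u → if u then ⌊ φ g ≟Fl τ0 (φ f) ⌋ else ⌊ φ g ≟Fl τ2 (φ f) ⌋) (lookup-complement A e) ⟨
  (if e ∈ₑ complement A then ⌊ φ g ≟Fl τ0 (φ f) ⌋ else ⌊ φ g ≟Fl τ2 (φ f) ⌋)
    ≡⟨ ∧∨not∧≡if (e ∈ₑ complement A) _ _ ⟨
  (e ∈ₑ complement A ∧ ⌊ φ g ≟Fl τ0 (φ f) ⌋) ∨ (not (e ∈ₑ complement A) ∧ ⌊ φ g ≟Fl τ2 (φ f) ⌋) ∎)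
  where open ≡-Reasoning

boundaryAdj-∅ : ∀ {m} (τ1 : Flag m → Flag m) f g → boundaryAdj τ1 (complement (fullSet m)) f g ≡ vertexAdj τ1 f g
boundaryAdj-∅ {m} τ1 f g = cong (⌊ g ≟Fl τ1 f ⌋ ∨_) (begin
  (edgeOf f ∈ₑ ∅ ∧ ⌊ g ≟Fl τ0 f ⌋) ∨ (not (edgeOf f ∈ₑ ∅) ∧ ⌊ g ≟Fl τ2 f ⌋)
    ≡⟨ ∧∨not∧≡if (edgeOf f ∈ₑ ∅) _ _ ⟩
  (if edgeOf f ∈ₑ ∅ then ⌊ g ≟Fl τ0 f ⌋ else ⌊ g ≟Fl τ2 f ⌋)
    ≡⟨ cong (λ u → if u then ⌊ g ≟Fl τ0 f ⌋ else ⌊ g ≟Fl τ2 f ⌋)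
            (trans (lookup-complement (fullSet m) (edgeOf f)) (cong not (lookup-fullSet (edgeOf f)))) ⟩
  ⌊ g ≟Fl τ2 f ⌋ ∎)
  where
  open ≡-Reasoning
  ∅ : EdgeSet m
  ∅ = complement (fullSet m)

module _ where
  open import Data.Integer using (ℤ; +_; _-_; _*_) renaming (_+_ to _⊕_)
  open import Data.Integer.Tactic.RingSolver using (solve-∀)

  2*-distribˡ-- : ∀ x y → + 2 * (x - y) ≡ + 2 * x - + 2 * y
  2*-distribˡ-- = solve-∀

  -- The quantities of G* are separate variables here, identified with those of G
  -- by matching the hypotheses on refl.
  x-exponent-exchange : ∀ a a′ f v β r s {e βE βA s′} → e ≡ a + a′ → βE ≡ v → βA ≡ β → s′ ≡ s →
    ((((+ e) ⊕ (+ f)) - (+ βE)) - + 2 * (+ r)) - ((((+ a) ⊕ (+ f)) - (+ βA)) - + 2 * (+ s))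
    ≡ + 2 * (((+ a′) ⊕ (+ s′)) - (+ r)) - (((+ a′) ⊕ (+ v)) - (+ β))
  x-exponent-exchange a a′ f v β r s refl refl refl refl = identity (+ a) (+ a′) (+ f) (+ v) (+ β) (+ r) (+ s)
    where
    identity : ∀ a a′ f v β r s → ((((a ⊕ a′) ⊕ f) - v) - + 2 * r) - (((a ⊕ f) - β) - + 2 * s)
                                 ≡ + 2 * ((a′ ⊕ s) - r) - ((a′ ⊕ v) - β)
    identity = solve-∀

  z-exponent-exchange : ∀ a a′ v f β r s {e f′ βA} → e ≡ a + a′ → f′ ≡ f → βA ≡ β →
    + 2 * (((+ a) ⊕ (+ s)) - (+ r)) - (((+ a) ⊕ (+ f′)) - (+ βA))
    ≡ ((((+ e) ⊕ (+ v)) - (+ f)) - + 2 * (+ r)) - ((((+ a′) ⊕ (+ v)) - (+ β)) - + 2 * (+ s))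
  z-exponent-exchange a a′ v f β r s refl refl refl = identity (+ a) (+ a′) (+ v) (+ f) (+ β) (+ r) (+ s)
    where
    identity : ∀ a a′ v f β r s → + 2 * ((a ⊕ s) - r) - ((a ⊕ f) - β)
                                 ≡ ((((a ⊕ a′) ⊕ v) - f) - + 2 * r) - (((a′ ⊕ v) - β) - + 2 * s)
    identity = solve-∀

swapPairs : ℤ × ℤ × ℤ × ℤ → ℤ × ℤ × ℤ × ℤ
swapPairs (a , b , c , d) = (c , d , a , b)

swapPairs-involutive : ∀ k → swapPairs (swapPairs k) ≡ k
swapPairs-involutive (a , b , c , d) = refl

module _ (C : ColouredRibbonGraph) where
  open ColouredRibbonGraph C
  open RibbonGraph G
  private
    module P = Params C
    module Q = Params (dual C)

  nV-dual : Q.nV ≡ P.b P.E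
  nV-dual = cong (_+ nIso)
    (ncomp-conj _≟Fl_ φφ (map-φ-allFlags nE) allFlags-complete (vertexAdj-dual τ1))

  b-dual : ∀ A → Q.b A ≡ P.b (complement A)
  b-dual A = cong (_+ nIso)
    (ncomp-conj _≟Fl_ φφ (map-φ-allFlags nE) allFlags-complete (boundaryAdj-dual τ1 A))

  b-∅ : P.b (complement P.E) ≡ P.nV
  b-∅ = cong (_+ nIso) (ncomp-cong _≟Fl_ (allFlags nE) (boundaryAdj-∅ τ1))

  w-exponent-dual : ∀ A → Q.2r₁ Q.E ℤ.- Q.2r₁ A ≡ P.2r₃ (complement A)
  w-exponent-dual A = trans (sym (2*-distribˡ-- (ℤ.+ P.rB P.E) (ℤ.+ P.rB A)))
    (cong (λ B → ℤ.+ 2 ℤ.* (ℤ.+ P.rB P.E ℤ.- ℤ.+ P.rB B)) (sym (complement-involutive A)))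

  x-exponent-dual : ∀ A → Q.2r₂ Q.E ℤ.- Q.2r₂ A ≡ P.2r₄ (complement A)
  x-exponent-dual A = x-exponent-exchange (card A) (card (complement A)) Q.nV P.nV (P.b (complement A))
    (P.rB P.E) (P.rB A) (card-fullSet-split A) (trans (b-dual P.E) b-∅) (b-dual A) (cong P.rB (complement-involutive A))

  y-exponent-dual : ∀ A → Q.2r₃ A ≡ P.2r₁ P.E ℤ.- P.2r₁ (complement A)
  y-exponent-dual A = 2*-distribˡ-- (ℤ.+ P.rV P.E) (ℤ.+ P.rV (complement A))

  z-exponent-dual : ∀ A → Q.2r₄ A ≡ P.2r₂ P.E ℤ.- P.2r₂ (complement A)
  z-exponent-dual A = z-exponent-exchange (card A) (card (complement A)) P.nV (P.b P.E) (P.b (complement A))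
    (P.rV P.E) (P.rV (complement A)) (card-fullSet-split A) nV-dual (b-dual A)

  exps-dual : ∀ A → Q.exps A ≡ swapPairs (P.exps (complement A))
  exps-dual A = cong₂ _,_ (w-exponent-dual A)
               (cong₂ _,_ (x-exponent-dual A) (cong₂ _,_ (y-exponent-dual A) (z-exponent-dual A)))

  exps-dual-≐ : ∀ k → (λ A → Q.exps A ≡ k) ≐ (λ A → P.exps (complement A) ≡ swapPairs k)
  exps-dual-≐ k = (λ {A} eq → trans (sym (swapPairs-involutive _)) (cong swapPairs (trans (sym (exps-dual A)) eq)))
                , (λ {A} eq → trans (exps-dual A) (trans (cong swapPairs eq) (swapPairs-involutive k)))

theorem3p8 : (C : ColouredRibbonGraph) → ∀ k → Tps (dual C) k ≡ substYZWX (Tps C) k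
theorem3p8 C k@(_ , _ , _ , _) = begin
  length (filter (λ A → Q.exps A ≟ℤ⁴ k) (allSubsets nE))
    ≡⟨ cong length (filter-≐ _ _ (exps-dual-≐ C k) (allSubsets nE)) ⟩
  length (filter (λ A → P.exps (complement A) ≟ℤ⁴ swapPairs k) (allSubsets nE))
    ≡⟨ count-complement nE (λ A → P.exps A ≟ℤ⁴ swapPairs k) ⟨
  length (filter (λ A → P.exps A ≟ℤ⁴ swapPairs k) (allSubsets nE)) ∎
  where
  open ≡-Reasoning
  open ColouredRibbonGraph C
  open RibbonGraph G
  module P = Params C
  module Q = Params (dual C)
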